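{- Consider a ranking-fair schedule in which team $1$ plays at home against team $2$. For any two distinct teams $i,j$: if $i$ and $j$ have the same parity, the stronger of the two (the one with smaller index) plays away in their match; if $i$ and $j$ have different parity, the stronger one plays at home.
   Context: Teams are $T=\{1,\dots,n\}$ ($n$ even), ranked by strength: team $i$ is stronger than team $j$ iff $i<j$. A schedule assigns to each unordered pair of distinct teams a round in $\{1,\dots,n-1\}$ and designates which of the two plays at home (the other away). The ranking HAP of team $i$ is the vector $(p_1,\dots,p_{n-1})$, $p_m\in\{H,A\}$ indicating whether team $i$ plays home or away against its $m$-th strongest opponent (opponents in increasing order of index). A schedule is ranking-fair if every team's ranking HAP alternates between $H$ and $A$. -}

module Defs where

open import Data.Nat using (ℕ; zero; suc; _∸_; _<_)
open import Data.Nat.Properties using ()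
open import Data.Fin using (Fin; toℕ)
open import Data.Bool using (Bool; true; false; not)
open import Data.List using (List; []; _∷_; filter)
open import Data.List using (allFin)
open import Data.Product using (_×_)
open import Relation.Binary.PropositionalEquality using (_≡_; _≢_)
open import Relation.Nullary using (¬_)
open import Relation.Nullary.Decidable using (¬?)
open import Data.Fin using (_≟_)

-- Teams are Fin n; the Agda team k : Fin n is the paper's team toℕ k + 1.
-- Team a is stronger than team b iff toℕ a < toℕ b.
-- Home/away: H = true, A = false.

-- A schedule for n teams (n even) with rounds 1..n-1 (here Fin (n ∸ 1)).
-- round a b : the round in which a and b meet;
-- home a b  : true iff team a plays at home in its match against b.
record Schedule (n : ℕ) : Set where
  field
    round : Fin n → Fin n → Fin (n ∸ 1)
    home  : Fin n → Fin n → Bool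
    round-sym : ∀ a b → round a b ≡ round b a
    home-opp  : ∀ a b → a ≢ b → home b a ≡ not (home a b)
    round-inj : ∀ a b c → b ≢ a → c ≢ a → round a b ≡ round a c → b ≡ c
open Schedule public

opponents : {n : ℕ} → Fin n → List (Fin n)
opponents {n} a = filter (λ b → ¬? (b ≟ a)) (allFin n)

rankingHAP : {n : ℕ} → Schedule n → Fin n → List Bool
rankingHAP s a = Data.List.map (home s a) (opponents a)

data Alternating : List Bool → Set where
  alt-[]  : Alternating []
  alt-one : ∀ x → Alternating (x ∷ [])
  alt-∷   : ∀ x y xs → x ≢ y → Alternating (y ∷ xs) → Alternating (x ∷ y ∷ xs)

RankingFair : {n : ℕ} → Schedule n → Set
RankingFair s = ∀ a → Alternating (rankingHAP s a)

{-# OPTIONS --safe #-}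
-- Alternation determines a team's whole ranking HAP from its first entry.
-- Team 1 is at home to team 2, so it hosts exactly the teams of even index.
-- Every other team j opens its HAP against team 1, so that entry is fixed too,
-- and its stronger opponents 1, …, j − 1 come first and in order; hence j hosts
-- a stronger i iff i ≡ j (mod 2), i.e. i hosts j iff their parities differ.
module Submission where

open import Defs
open import Data.Nat using (ℕ; suc; _<_; _%_)
open import Data.Fin using (Fin; toℕ; zero; suc)
open import Data.Bool using (Bool; true; false)
open import Data.Product using (_×_)
open import Relation.Binary.PropositionalEquality using (_≡_; _≢_)

open import Data.Bool using (not)
open import Data.Bool.Properties using (not-involutive; ¬-not)
open import Data.Fin using (punchIn; _≟_)
open import Data.Fin.Properties using (0≢1+n; <⇒≢)
open import Data.List using (List; []; _∷_; map; filter; tabulate)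
open import Data.List.Properties using (map-tabulate; filter-all)
open import Data.List.Relation.Unary.All.Properties using (tabulate⁺)
open import Data.Nat using (_+_; s≤s)
open import Data.Nat.GeneralisedArithmetic using (fold; fold-+)
open import Data.Nat.Properties using () renaming (_≟_ to _≟ℕ_)
open import Data.Product using (_,_; ∃-syntax)
open import Function using (id; _∘_)
open import Relation.Binary.PropositionalEquality using (refl; sym; trans; cong; subst; module ≡-Reasoning)
open import Relation.Nullary using (does; ¬?)
open import Relation.Nullary.Decidable using (dec-true; dec-false)
open ≡-Reasoning

fold-not-shift : ∀ b k → fold (not b) not k ≡ not (fold b not k)
fold-not-shift b 0       = refl
fold-not-shift b (suc k) = cong not (fold-not-shift b k)

-- The recursion relies on suc (suc n) % 2 reducing to n % 2.
fold-not-+ : ∀ m n → fold true not (m + n) ≡ does (m % 2 ≟ℕ n % 2)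
fold-not-+ 0             0             = refl
fold-not-+ 0             1             = refl
fold-not-+ 0             (suc (suc n)) = trans (not-involutive _) (fold-not-+ 0 n)
fold-not-+ 1             0             = refl
fold-not-+ 1             1             = refl
fold-not-+ 1             (suc (suc n)) = trans (not-involutive _) (fold-not-+ 1 n)
fold-not-+ (suc (suc m)) n             = trans (not-involutive _) (fold-not-+ m n)

alternating-tabulate : ∀ {n} {g : Fin (suc n) → Bool} → Alternating (tabulate g) →
                       ∀ k → g k ≡ fold (g zero) not (toℕ k)
alternating-tabulate           _                          zero    = refl
alternating-tabulate {suc n} {g} (alt-∷ _ _ _ g₀≢g₁ alt) (suc k) = begin
  g (suc k)                         ≡⟨ alternating-tabulate {g = g ∘ suc} alt k ⟩
  fold (g (suc zero)) not (toℕ k)   ≡⟨ cong (λ b → fold b not (toℕ k)) (¬-not (g₀≢g₁ ∘ sym)) ⟩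
  fold (not (g zero)) not (toℕ k)   ≡⟨ fold-not-shift (g zero) (toℕ k) ⟩
  not (fold (g zero) not (toℕ k))   ∎

filter-≢-map-suc : ∀ {n} (a : Fin n) (xs : List (Fin n)) →
                   filter (λ b → ¬? (b ≟ suc a)) (map suc xs)
                   ≡ map suc (filter (λ b → ¬? (b ≟ a)) xs)
filter-≢-map-suc a []       = refl
filter-≢-map-suc a (x ∷ xs) with does (x ≟ a)
... | true  = filter-≢-map-suc a xs
... | false = cong (suc x ∷_) (filter-≢-map-suc a xs)

opponents≡tabulate-punchIn : ∀ {n} (a : Fin (suc n)) → opponents a ≡ tabulate (punchIn a)
opponents≡tabulate-punchIn zero    = filter-all (λ b → ¬? (b ≟ zero)) (tabulate⁺ (λ _ ()))
opponents≡tabulate-punchIn {suc n} (suc a) = cong (zero ∷_) (begin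
  filter (λ b → ¬? (b ≟ suc a)) (tabulate suc)
    ≡⟨ cong (filter (λ b → ¬? (b ≟ suc a))) (sym (map-tabulate id suc)) ⟩
  filter (λ b → ¬? (b ≟ suc a)) (map suc (tabulate id)) ≡⟨ filter-≢-map-suc a (tabulate id) ⟩
  map suc (opponents a)                                 ≡⟨ cong (map suc) (opponents≡tabulate-punchIn a) ⟩
  map suc (tabulate (punchIn a))                        ≡⟨ map-tabulate (punchIn a) suc ⟩
  tabulate (suc ∘ punchIn a)                            ∎)

alternating-opponents : ∀ {n} (f : Fin (suc (suc n)) → Bool) a → Alternating (map f (opponents a)) →
                        ∀ k → f (punchIn a k) ≡ fold (f (punchIn a zero)) not (toℕ k)
alternating-opponents f a alt = alternating-tabulate (subst Alternating tabulated alt)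
  where
  tabulated : map f (opponents a) ≡ tabulate (f ∘ punchIn a)
  tabulated = trans (cong (map f) (opponents≡tabulate-punchIn a)) (map-tabulate (punchIn a) f)

punchIn-below : ∀ {n} {i j : Fin (suc n)} → toℕ i < toℕ j → ∃[ k ] punchIn j k ≡ i × toℕ k ≡ toℕ i
punchIn-below {suc n} {zero}  {suc j} _         = zero , refl , refl
punchIn-below {suc n} {suc i} {suc j} (s≤s i<j) with punchIn-below i<j
... | k , refl , toℕk≡toℕi = suc k , refl , cong suc toℕk≡toℕi

module _ {m} (s : Schedule (suc (suc m))) (fair : RankingFair s) where

  home-against-stronger : ∀ {i j} → toℕ i < toℕ (suc j) →
                          home s (suc j) i ≡ fold (home s (suc j) zero) not (toℕ i)
  home-against-stronger {j = j} i<j with punchIn-below i<j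
  ... | k , refl , toℕk≡toℕi =
    trans (alternating-opponents (home s (suc j)) (suc j) (fair (suc j)) k)
          (cong (fold (home s (suc j) zero) not) toℕk≡toℕi)

  module _ (home₀₁ : home s zero (suc zero) ≡ true) where

    home-of-team₀ : ∀ k → home s zero (suc k) ≡ fold true not (toℕ k)
    home-of-team₀ k = trans (alternating-opponents (home s zero) zero (fair zero) k)
                            (cong (λ b → fold b not (toℕ k)) home₀₁)

    home-against-stronger≡same-parity : ∀ {i j} → toℕ i < toℕ (suc j) →
                                        home s (suc j) i ≡ does (toℕ i % 2 ≟ℕ toℕ (suc j) % 2)
    home-against-stronger≡same-parity {i} {j} i<j = begin
      home s (suc j) i                           ≡⟨ home-against-stronger i<j ⟩
      fold (home s (suc j) zero) not I           ≡⟨ cong (λ b → fold b not I) (home-opp s zero (suc j) 0≢1+n) ⟩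
      fold (not (home s zero (suc j))) not I     ≡⟨ cong (λ b → fold (not b) not I) (home-of-team₀ j) ⟩
      fold (fold true not J) not I               ≡⟨ sym (fold-+ true not I) ⟩
      fold true not (I + J)                      ≡⟨ fold-not-+ I J ⟩
      does (I % 2 ≟ℕ J % 2)                      ∎
      where
      I J : ℕ
      I = toℕ i
      J = toℕ (suc j)

lemma1 : (m : ℕ) → m % 2 ≡ 0 → (s : Schedule (suc (suc m))) → RankingFair s
    → home s zero (suc zero) ≡ true
    → (i j : Fin (suc (suc m))) → toℕ i < toℕ j
    → (toℕ i % 2 ≡ toℕ j % 2 → home s i j ≡ false)
    × (toℕ i % 2 ≢ toℕ j % 2 → home s i j ≡ true)
lemma1 m _ s fair home₀₁ i zero    ()
lemma1 m _ s fair home₀₁ i (suc j) i<j =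
  (λ same → trans home-ij (cong not (dec-true  (_ ≟ℕ _) same))) ,
  (λ diff → trans home-ij (cong not (dec-false (_ ≟ℕ _) diff)))
  where
  home-ij : home s i (suc j) ≡ not (does (toℕ i % 2 ≟ℕ toℕ (suc j) % 2))
  home-ij = trans (home-opp s (suc j) i (<⇒≢ i<j ∘ sym))
                  (cong not (home-against-stronger≡same-parity s fair home₀₁ i<j))
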